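{- Let $h:\mathbb{Z}_{\ge0}\to\mathbb{Z}_{\ge0}$ be nondecreasing and satisfy: for all $z,z'\in\mathbb{Z}_{\ge0}$ and every positive integer $i$, if $\lfloor z/2^i\rfloor=\lfloor z'/2^i\rfloor$ then $\lfloor h(z)/2^{i-1}\rfloor=\lfloor h(z')/2^{i-1}\rfloor$. Let $z_k,y_k\in\{0,1\}$ for $k=0,\dots,n$ and suppose $h\left(\sum_{k=0}^n z_k2^k\right)\ge\sum_{k=0}^n y_k2^k$. Then for every positive integer $i$, $h\left(\sum_{k=i}^n z_k2^k\right)\ge\sum_{k=i-1}^n y_k2^k$. -}

module Defs where

open import Data.Nat using (ℕ; zero; suc; _+_; _*_; _^_; _/_; _≤_; _<_)
open import Data.Nat.Properties using (m^n≢0)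
open import Data.Bool using (Bool)
import Data.Nat
import Relation.Nullary
open import Data.Bool using (true; false)

bitVal : Bool → ℕ
bitVal true = 1
bitVal false = 0

shiftDiv : ℕ → ℕ → ℕ
shiftDiv z i = _/_ z (2 ^ i) {{m^n≢0 2 i}}

-- bitSum b a n = Σ_{k=a}^{n} b_k 2^k   (empty sum = 0 when a > n)
-- defined by recursion on the upper index n
bitSum : (ℕ → Bool) → ℕ → ℕ → ℕ
bitSum b a zero = if0 a
  where
  if0 : ℕ → ℕ
  if0 zero = bitVal (b 0)
  if0 (suc _) = 0
bitSum b a (suc n) = bitSum b a n + term
  where
  term : ℕ
  term with Data.Nat._≤?_ a (suc n)
  ... | Relation.Nullary.yes _ = bitVal (b (suc n)) * 2 ^ suc n
  ... | Relation.Nullary.no _ = 0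

-- Cutting off the bits below position a does not change the quotient by 2^a.
-- Hence the hypothesis on h, applied to Z = Σ_{k≥0} z_k 2^k and Z_{j+1} = Σ_{k>j} z_k 2^k,
-- gives ⌊h(Z)/2^j⌋ = ⌊h(Z_{j+1})/2^j⌋, while Y_j = Σ_{k≥j} y_k 2^k is a multiple of 2^j
-- with ⌊Y_j/2^j⌋ = ⌊Y/2^j⌋ ≤ ⌊h(Z)/2^j⌋. A multiple of d whose quotient by d is at most
-- ⌊x/d⌋ is at most x.
module Submission where

open import Defs
open import Data.Nat using (ℕ; zero; suc; _+_; _*_; _∸_; _^_; _/_; _≤_; _<_; _≤?_; z≤n; s≤s; NonZero)
open import Data.Nat.Properties
open import Data.Nat.DivMod using (m/n*n≡m; m/n*n≤m; /-monoˡ-≤; m<n⇒m/n≡0; +-distrib-/-∣ˡ)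
open import Data.Nat.Divisibility using (_∣_; _∣0; 1∣_; ∣-trans; ∣m∣n⇒∣m+n; m∣m*n; n∣m*n)
open import Data.Bool using (Bool; true; false)
open import Data.Product using (∃-syntax; _×_; _,_)
open import Relation.Nullary using (yes; no)
open import Relation.Nullary.Negation using (contradiction)
open import Relation.Binary.PropositionalEquality using (_≡_; refl; sym; trans; cong; subst; module ≡-Reasoning)

^-monoʳ-∣ : ∀ k {m n} → m ≤ n → k ^ m ∣ k ^ n
^-monoʳ-∣ k {m} {n} m≤n = subst (k ^ m ∣_) k^[m+[n∸m]]≡k^n (m∣m*n (k ^ (n ∸ m)))
  where
  k^[m+[n∸m]]≡k^n : k ^ m * k ^ (n ∸ m) ≡ k ^ n
  k^[m+[n∸m]]≡k^n = trans (sym (^-distribˡ-+-* k m (n ∸ m))) (cong (k ^_) (m+[n∸m]≡n m≤n))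

[m+r]/d≡m/d : ∀ {m r d} .{{_ : NonZero d}} → d ∣ m → r < d → (m + r) / d ≡ m / d
[m+r]/d≡m/d {m} {r} {d} d∣m r<d = begin
  (m + r) / d    ≡⟨ +-distrib-/-∣ˡ r d∣m ⟩
  m / d + r / d  ≡⟨ cong (m / d +_) (m<n⇒m/n≡0 r<d) ⟩
  m / d + 0      ≡⟨ +-identityʳ (m / d) ⟩
  m / d          ∎
  where open ≡-Reasoning

∣∧/-mono-≤⇒≤ : ∀ {m n d} .{{_ : NonZero d}} → d ∣ m → m / d ≤ n / d → m ≤ n
∣∧/-mono-≤⇒≤ {m} {n} {d} d∣m m/d≤n/d = begin
  m          ≡⟨ m/n*n≡m d∣m ⟨
  m / d * d  ≤⟨ *-monoˡ-≤ d m/d≤n/d ⟩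
  n / d * d  ≤⟨ m/n*n≤m n d ⟩
  n          ∎
  where open ≤-Reasoning

bitVal≤1 : ∀ x → bitVal x ≤ 1
bitVal≤1 true  = s≤s z≤n
bitVal≤1 false = z≤n

bitSum-step : ∀ b {a} n → a ≤ suc n → bitSum b a (suc n) ≡ bitSum b a n + bitVal (b (suc n)) * 2 ^ suc n
bitSum-step b {a} n a≤1+n with a ≤? suc n
... | yes _      = refl
... | no a≰1+n   = contradiction a≤1+n a≰1+n

bitSum-empty : ∀ b {a} n → n < a → bitSum b a n ≡ 0
bitSum-empty b {suc a} zero _ = refl
bitSum-empty b {a} (suc n) n<a with a ≤? suc n
... | yes a≤n = contradiction a≤n (<⇒≱ n<a)
... | no _    = trans (+-identityʳ _) (bitSum-empty b n (<-trans (n<1+n n) n<a))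

bitSum<2^suc : ∀ b n → bitSum b 0 n < 2 ^ suc n
bitSum<2^suc b zero    = s≤s (bitVal≤1 (b 0))
bitSum<2^suc b (suc n) = begin-strict
  bitSum b 0 n + bitVal (b (suc n)) * 2 ^ suc n
    <⟨ +-mono-<-≤ (bitSum<2^suc b n) (*-monoˡ-≤ (2 ^ suc n) (bitVal≤1 (b (suc n)))) ⟩
  2 ^ suc (suc n)
    ∎
  where open ≤-Reasoning

2^a∣bitSum : ∀ b a n → 2 ^ a ∣ bitSum b a n
2^a∣bitSum b zero    zero = 1∣ _
2^a∣bitSum b (suc a) zero = _ ∣0
2^a∣bitSum b a (suc n) with a ≤? suc n
... | yes a≤1+n = ∣m∣n⇒∣m+n (2^a∣bitSum b a n) (∣-trans (^-monoʳ-∣ 2 a≤1+n) (n∣m*n (bitVal (b (suc n)))))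
... | no _      = subst (2 ^ a ∣_) (sym (+-identityʳ _)) (2^a∣bitSum b a n)

bitSum-split : ∀ b a n → ∃[ r ] r < 2 ^ a × bitSum b 0 n ≡ bitSum b a n + r
bitSum-split b a n with a ≤? n
... | no a≰n = bitSum b 0 n
             , <-≤-trans (bitSum<2^suc b n) (^-monoʳ-≤ 2 (≰⇒> a≰n))
             , cong (_+ bitSum b 0 n) (sym (bitSum-empty b n (≰⇒> a≰n)))
bitSum-split b zero    zero    | yes _     = 0 , s≤s z≤n , sym (+-identityʳ _)
bitSum-split b a       (suc n) | yes a≤1+n with bitSum-split b a n
... | r , r<2^a , eq = r , r<2^a , (begin
  bitSum b 0 n + t        ≡⟨ cong (_+ t) eq ⟩
  bitSum b a n + r + t    ≡⟨ +-assoc (bitSum b a n) r t ⟩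
  bitSum b a n + (r + t)  ≡⟨ cong (bitSum b a n +_) (+-comm r t) ⟩
  bitSum b a n + (t + r)  ≡⟨ +-assoc (bitSum b a n) t r ⟨
  bitSum b a n + t + r    ≡⟨ cong (_+ r) (bitSum-step b n a≤1+n) ⟨
  bitSum b a (suc n) + r  ∎)
  where
  open ≡-Reasoning
  t : ℕ
  t = bitVal (b (suc n)) * 2 ^ suc n

shiftDiv-bitSum : ∀ b a n → shiftDiv (bitSum b 0 n) a ≡ shiftDiv (bitSum b a n) a
shiftDiv-bitSum b a n with bitSum-split b a n
... | r , r<2^a , eq = trans (cong (λ m → shiftDiv m a) eq) ([m+r]/d≡m/d (2^a∣bitSum b a n) r<2^a)
  where instance _ = m^n≢0 2 a

mainTheorem9 : (h : ℕ → ℕ) → (∀ {z z′} → z ≤ z′ → h z ≤ h z′) → (∀ z z′ (j : ℕ) → shiftDiv z (suc j) ≡ shiftDiv z′ (suc j) → shiftDiv (h z) j ≡ shiftDiv (h z′) j) → (n : ℕ) → (zs ys : ℕ → Bool) → bitSum ys 0 n ≤ h (bitSum zs 0 n) → (j : ℕ) → bitSum ys j n ≤ h (bitSum zs (suc j) n)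
mainTheorem9 h _ h-shift n zs ys Y≤hZ j = ∣∧/-mono-≤⇒≤ (2^a∣bitSum ys j n) (begin
  shiftDiv (bitSum ys j n) j            ≡⟨ shiftDiv-bitSum ys j n ⟨
  shiftDiv (bitSum ys 0 n) j            ≤⟨ /-monoˡ-≤ (2 ^ j) Y≤hZ ⟩
  shiftDiv (h (bitSum zs 0 n)) j        ≡⟨ h-shift _ _ j (shiftDiv-bitSum zs (suc j) n) ⟩
  shiftDiv (h (bitSum zs (suc j) n)) j ∎)
  where
  open ≤-Reasoning
  instance _ = m^n≢0 2 j
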